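{- Let $a\geq 3$ and $m\geq 2a^2-a+2$ be integers, let $C(m,a)=\left\lceil\frac{m-1}{a}\left\lceil\frac{m-1}{a}\right\rceil\right\rceil$, and suppose the set $\{1,\ldots,C(m,a)\}$ is colored red and blue so that there is no monochromatic solution of $x_1+\cdots+x_{m-1}=ax_m$, with both $a-2$ and $a-1$ red. Then all of the numbers $m-3, m-2, m-1, \ldots, 2m-2$ are blue.
   Context: A solution is an assignment of values in $\{1,\ldots,C(m,a)\}$ to $x_1,\ldots,x_m$ (not necessarily distinct) making the equation true; it is monochromatic if all the values $x_1,\ldots,x_m$ have the same color. (Under these hypotheses $2m-2\le C(m,a)$.) -}

module Defs where

open import Data.Nat using (ℕ; zero; suc; _+_; _*_; _∸_; _≤_; _<_; NonZero)
open import Data.Nat.DivMod using (_/_)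
open import Data.Bool using (Bool; true; false)
open import Data.Vec using (Vec; sum)
open import Data.Vec.Relation.Unary.All using (All)
open import Relation.Binary.PropositionalEquality using (_≡_)
open import Data.Product using (_×_)

⌈_/_⌉ : ℕ → (d : ℕ) → .{{NonZero d}} → ℕ
⌈ n / d ⌉ = (n + (d ∸ 1)) / d

C : (m a : ℕ) → .{{NonZero a}} → ℕ
C m a = ⌈ (m ∸ 1) * ⌈ (m ∸ 1) / a ⌉ / a ⌉

-- a coloring of ℕ (only values on {1..N} matter); true = red, false = blue
Coloring : Set
Coloring = ℕ → Bool

red blue : Bool
red = true
blue = false

InRange : ℕ → ℕ → Set
InRange N x = 1 ≤ x × x ≤ N

IsSolution : (N m a : ℕ) → Vec ℕ (m ∸ 1) → ℕ → Set
IsSolution N m a xs xm =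
  All (InRange N) xs × InRange N xm × sum xs ≡ a * xm

Monochromatic : Coloring → Bool → {k : ℕ} → Vec ℕ k → ℕ → Set
Monochromatic χ c xs xm = All (λ x → χ x ≡ c) xs × χ xm ≡ c

NoMonoSolution : Coloring → (N m a : ℕ) → Set
NoMonoSolution χ N m a =
  (xs : Vec ℕ (m ∸ 1)) (xm : ℕ) (c : Bool) →
  IsSolution N m a xs xm → Monochromatic χ c xs xm → Data.Empty.⊥
  where import Data.Empty

module Submission where

-- Write a = b + 2 (so b = a - 2 and b + 1 = a - 1 are the two red numbers)
-- and m = n + 1 with n = a + p, so that an equation has n summands.
-- A red k in the window [n - 2, 2n] yields a red solution with x_m = k:
-- take j copies of k and p + u numbers from {b, b+1, b+2 = a}, where
-- u + j = a; this works as soon as (p + u)·b ≤ u·k ≤ (p + u)·a, because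
-- every integer between s·b and s·(b+2) is a sum of s numbers from
-- {b, b+1, b+2}.  For this to be colour-consistent we first show that n
-- is blue and that a is red, again by exhibiting explicit solutions.

open import Defs
open import Data.Nat using (ℕ; zero; suc; _+_; _*_; _∸_; _≤_; _<_; _≤?_; z≤n; s≤s; NonZero)
open import Data.Nat.Properties
open import Data.Nat.DivMod using (_/_; m*n/n≡m; /-monoˡ-≤)
open import Data.Nat.Tactic.RingSolver using (solve-∀)
open import Data.Bool using (Bool; true; false)
open import Data.Vec using (Vec; []; _∷_; sum; _++_)
open import Data.Vec.Properties using (sum-++)
open import Data.Vec.Relation.Unary.All as All using (All; []; _∷_)
open import Data.Vec.Relation.Unary.All.Properties using (++⁺)
open import Data.Product using (Σ; _×_; _,_; proj₁; proj₂)
open import Data.Sum using (_⊎_; inj₁; inj₂)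
open import Data.Empty using (⊥; ⊥-elim)
open import Relation.Nullary using (yes; no)
open import Relation.Binary using (tri<; tri≈; tri>)
open import Relation.Binary.PropositionalEquality

SumOf : (ℕ → Set) → ℕ → ℕ → Set
SumOf P n T = Σ (Vec ℕ n) λ xs → sum xs ≡ T × All P xs

copies : ∀ {P : ℕ → Set} n x → P x → SumOf P n (n * x)
copies zero    x px = [] , refl , []
copies (suc n) x px with copies n x px
... | xs , xs-sum , xs-all = x ∷ xs , cong (x +_) xs-sum , px ∷ xs-all

_⊕_ : ∀ {P : ℕ → Set} {n n′ T T′} → SumOf P n T → SumOf P n′ T′ → SumOf P (n + n′) (T + T′)
(xs , xs-sum , xs-all) ⊕ (ys , ys-sum , ys-all) =
  xs ++ ys , trans (sum-++ xs) (cong₂ _+_ xs-sum ys-sum) , ++⁺ xs-all ys-all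

recount : ∀ {P : ℕ → Set} {n n′ T T′} → n ≡ n′ → T ≡ T′ → SumOf P n T → SumOf P n′ T′
recount refl refl σ = σ

excess-bound : ∀ s b t → s * b + (s + t) ≤ s * (2 + b) → t ≤ s
excess-bound s b t le = +-cancelˡ-≤ s t s (+-cancelˡ-≤ (s * b) (s + t) (s + s)
                          (≤-trans le (≤-reflexive (spread s b))))
  where
  spread : ∀ s b → s * (2 + b) ≡ s * b + (s + s)
  spread = solve-∀

-- Every T with s·b ≤ T ≤ s·(b+2) is a sum of s numbers from {b, b+1, b+2}:
-- writing T = s·b + e, use e copies of b+1 if e ≤ s, and otherwise
-- e - s copies of b+2 with the remaining terms equal to b+1.
consecutive-sum : ∀ {P : ℕ → Set} s b T → s * b ≤ T → T ≤ s * (2 + b) →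
  P b → P (1 + b) → P (2 + b) → SumOf P s T
consecutive-sum s b T lo hi Pb Pb+1 Pb+2 with m≤n⇒∃[o]m+o≡n lo
... | e , refl with ≤-total e s
...   | inj₁ e≤s with m≤n⇒∃[o]m+o≡n e≤s
...     | r , refl = recount (+-comm r e) (low-terms e r b) (copies r b Pb ⊕ copies e (1 + b) Pb+1)
  where
  low-terms : ∀ e r b → r * b + e * (1 + b) ≡ (e + r) * b + e
  low-terms = solve-∀
consecutive-sum s b T lo hi Pb Pb+1 Pb+2
  | e , refl | inj₂ s≤e with m≤n⇒∃[o]m+o≡n s≤e
...     | t , refl with m≤n⇒∃[o]m+o≡n (excess-bound s b t hi)
...       | r , refl = recount (+-comm r t) (high-terms t r b) (copies r (1 + b) Pb+1 ⊕ copies t (2 + b) Pb+2)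
  where
  high-terms : ∀ t r b → r * (1 + b) + t * (2 + b) ≡ (t + r) * b + ((t + r) + t)
  high-terms = solve-∀

largest-fit : ∀ a d N → Σ ℕ λ v → v ≤ a × v * d ≤ N × (v ≡ a ⊎ N < suc v * d)
largest-fit zero    d N = 0 , z≤n , z≤n , inj₁ refl
largest-fit (suc a) d N with largest-fit a d N
... | v , v≤a , fits , inj₂ over = v , m≤n⇒m≤1+n v≤a , fits , inj₂ over
... | v , v≤a , fits , inj₁ refl with suc v * d ≤? N
...   | yes fits′ = suc v , ≤-refl , fits′ , inj₁ refl
...   | no ¬fits  = v , n≤1+n v , fits , inj₂ (≰⇒> ¬fits)

-- Compare b with 2v:
-- b < 2v is a direct estimate, b = 2v gives 2p < d, and b > 2v would
-- give (v + 1)·d ≤ p·(b+2).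
overshoot-bound : ∀ b p d v → (2 + b) * (1 + b) ≤ p + p → d ≤ (p + p) + (2 + b) →
  p * (2 + b) < suc v * d → p * b ≤ v * (d + 2)
overshoot-bound b p d v small d≤ over with <-cmp b (v + v)
... | tri< b<2v _ _ = +-cancelʳ-≤ (suc (p + p)) (p * b) (v * (d + 2)) (begin
  p * b + suc (p + p)              ≡⟨ close b p ⟩
  suc (p * (2 + b))                ≤⟨ over ⟩
  d + v * d                        ≤⟨ +-monoˡ-≤ (v * d) d≤ ⟩
  (p + p) + (2 + b) + v * d        ≤⟨ +-monoˡ-≤ (v * d) (+-monoʳ-≤ (p + p) (s≤s b<2v)) ⟩
  (p + p) + suc (v + v) + v * d    ≡⟨ regroup p v d ⟩
  v * (d + 2) + suc (p + p)        ∎)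
  where
  open ≤-Reasoning
  close : ∀ b p → p * b + suc (p + p) ≡ suc (p * (2 + b))
  close = solve-∀
  regroup : ∀ p v d → (p + p) + suc (v + v) + v * d ≡ v * (d + 2) + suc (p + p)
  regroup = solve-∀
... | tri≈ _ refl _ = begin
  p * (v + v)  ≡⟨ swap p v ⟩
  v * (p + p)  ≤⟨ *-monoʳ-≤ v (≤-trans (<⇒≤ 2p<d) (m≤m+n d 2)) ⟩
  v * (d + 2)  ∎
  where
  open ≤-Reasoning
  swap : ∀ p v → p * (v + v) ≡ v * (p + p)
  swap = solve-∀
  halve : ∀ p v → p * (2 + (v + v)) ≡ suc v * (p + p)
  halve = solve-∀
  2p<d : p + p < d
  2p<d = *-cancelˡ-< (suc v) (p + p) d (subst (_< suc v * d) (halve p v) over)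
... | tri> _ _ 2v<b = ⊥-elim (<⇒≱ over (*-cancelˡ-≤ 2 (begin
  2 * (suc v * d)                        ≡⟨ double v d ⟩
  (2 + (v + v)) * d                      ≤⟨ *-monoˡ-≤ d (s≤s 2v<b) ⟩
  (1 + b) * d                            ≤⟨ *-monoʳ-≤ (1 + b) d≤ ⟩
  (1 + b) * ((p + p) + (2 + b))          ≡⟨ expand b p ⟩
  (1 + b) * (p + p) + (2 + b) * (1 + b)  ≤⟨ +-monoʳ-≤ ((1 + b) * (p + p)) small ⟩
  (1 + b) * (p + p) + (p + p)            ≡⟨ collect b p ⟩
  2 * (p * (2 + b))                      ∎)))
  where
  open ≤-Reasoning
  double : ∀ v d → 2 * (suc v * d) ≡ (2 + (v + v)) * d
  double = solve-∀
  expand : ∀ b p → (1 + b) * ((p + p) + (2 + b)) ≡ (1 + b) * (p + p) + (2 + b) * (1 + b)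
  expand = solve-∀
  collect : ∀ b p → (1 + b) * (p + p) + (p + p) ≡ 2 * (p * (2 + b))
  collect = solve-∀

-- The multiplier u ≤ b + 2 with u·d ≤ p·(b+2) and p·b ≤ u·(d+2): the
-- largest u satisfying the first inequality also satisfies the second.
multiplier : ∀ b p d → (2 + b) * (1 + b) ≤ p + p → p ≤ d + 2 → d ≤ (p + p) + (2 + b) →
  Σ ℕ λ u → u ≤ 2 + b × u * d ≤ p * (2 + b) × p * b ≤ u * (d + 2)
multiplier b p d small p≤ d≤ with largest-fit (2 + b) d (p * (2 + b))
... | u , u≤a , fits , inj₁ refl =
  u , u≤a , fits , ≤-trans (*-mono-≤ p≤ (m≤n+m b 2)) (≤-reflexive (*-comm (d + 2) (2 + b)))
... | u , u≤a , fits , inj₂ over = u , u≤a , fits , overshoot-bound b p d u small d≤ over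

multiplier-range : ∀ b p d u → u * d ≤ p * (2 + b) → p * b ≤ u * (d + 2) →
  (p + u) * b ≤ u * ((2 + b) + d) × u * ((2 + b) + d) ≤ (p + u) * (2 + b)
multiplier-range b p d u fits covers = lower , upper
  where
  open ≤-Reasoning
  split-lower : ∀ u d b → u * (d + 2) + u * b ≡ u * ((2 + b) + d)
  split-lower = solve-∀
  split-upper : ∀ u d b → u * ((2 + b) + d) ≡ u * d + u * (2 + b)
  split-upper = solve-∀
  lower : (p + u) * b ≤ u * ((2 + b) + d)
  lower = begin
    (p + u) * b          ≡⟨ *-distribʳ-+ b p u ⟩
    p * b + u * b        ≤⟨ +-monoˡ-≤ (u * b) covers ⟩
    u * (d + 2) + u * b  ≡⟨ split-lower u d b ⟩
    u * ((2 + b) + d)    ∎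
  upper : u * ((2 + b) + d) ≤ (p + u) * (2 + b)
  upper = begin
    u * ((2 + b) + d)          ≡⟨ split-upper u d b ⟩
    u * d + u * (2 + b)        ≤⟨ +-monoˡ-≤ (u * (2 + b)) fits ⟩
    p * (2 + b) + u * (2 + b)  ≡⟨ sym (*-distribʳ-+ (2 + b) p u) ⟩
    (p + u) * (2 + b)          ∎

module BlueWindow
  (b p N : ℕ) (χ : Coloring)
  (no-mono : NoMonoSolution χ N (suc (2 + b + p)) (2 + b))
  (1≤b : 1 ≤ b)
  (p-large : (2 + b) * (1 + b) ≤ p)
  (N-large : (2 + b + p) + (2 + b + p) ≤ N)
  (b-red : χ b ≡ red) (b+1-red : χ (suc b) ≡ red) where

  a n : ℕ
  a = 2 + b
  n = a + p

  Coloured : Bool → ℕ → Set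
  Coloured c x = InRange N x × χ x ≡ c

  in-range : ∀ x → 1 ≤ x → x ≤ n + n → InRange N x
  in-range x 1≤x x≤2n = 1≤x , ≤-trans x≤2n N-large

  small-in-range : ∀ x → 1 ≤ x → x ≤ a → InRange N x
  small-in-range x 1≤x x≤a = in-range x 1≤x (≤-trans (≤-trans x≤a (m≤m+n a p)) (m≤m+n n n))

  n-in-range : InRange N n
  n-in-range = in-range n (s≤s z≤n) (m≤m+n n n)

  forbidden : ∀ c x → SumOf (Coloured c) n (a * x) → Coloured c x → ⊥
  forbidden c x (xs , xs-sum , xs-all) (x-range , x-colour) =
    no-mono xs x c (All.map proj₁ xs-all , x-range , xs-sum) (All.map proj₂ xs-all , x-colour)

  b-coloured : Coloured red b
  b-coloured = small-in-range b 1≤b (m≤n+m b 2) , b-red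

  b+1-coloured : Coloured red (suc b)
  b+1-coloured = small-in-range (suc b) (s≤s z≤n) (n≤1+n (suc b)) , b+1-red

  b≤p : b ≤ p
  b≤p = ≤-trans (≤-trans (n≤1+n b) (m≤n*m (1 + b) (2 + b))) p-large

  2≤p : 2 ≤ p
  2≤p = ≤-trans (≤-trans (m≤m+n 2 b) (m≤m*n (2 + b) (1 + b))) p-large

  -- n is blue: otherwise 2·n + 2b·(b+1) + r·b = a·n, where p = b + r,
  -- is a red solution with x_m = n.
  n-blue : χ n ≡ blue
  n-blue with χ n in n-colour
  ... | false = refl
  ... | true with m≤n⇒∃[o]m+o≡n b≤p
  ...   | r , b+r≡p = ⊥-elim (forbidden red n witness (n-in-range , n-colour))
    where
    length-eq : ∀ b r → 2 + ((b + b) + r) ≡ 2 + b + (b + r)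
    length-eq = solve-∀
    sum-eq : ∀ b r → 2 * (2 + b + (b + r)) + ((b + b) * suc b + r * b) ≡ (2 + b) * (2 + b + (b + r))
    sum-eq = solve-∀
    witness : SumOf (Coloured red) n (a * n)
    witness = recount (trans (length-eq b r) (cong (a +_) b+r≡p))
                      (subst (λ q → 2 * (a + q) + ((b + b) * suc b + r * b) ≡ a * (a + q)) b+r≡p (sum-eq b r))
                      (copies 2 n (n-in-range , n-colour)
                        ⊕ (copies (b + b) (suc b) b+1-coloured ⊕ copies r b b-coloured))

  -- a is red: otherwise n copies of a and x_m = n form a blue solution.
  a-red : χ a ≡ red
  a-red with χ a in a-colour
  ... | true  = refl
  ... | false = ⊥-elim (forbidden blue n (recount refl (*-comm n a) (copies n a a-coloured)) (n-in-range , n-blue))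
    where
    a-coloured : Coloured blue a
    a-coloured = small-in-range a (s≤s z≤n) ≤-refl , a-colour

  -- k = a + d in the window is not red: j copies of k together with
  -- p + u red numbers from {b, b+1, a} summing to u·k give a red solution.
  window-not-red : ∀ d → p ≤ d + 2 → d ≤ (p + p) + a → a + d ≤ n + n → χ (a + d) ≡ red → ⊥
  window-not-red d p≤ d≤ k≤2n k-red
    with multiplier b p d (≤-trans p-large (m≤m+n p p)) p≤ d≤
  ... | u , u≤a , fits , covers with m≤n⇒∃[o]m+o≡n u≤a | multiplier-range b p d u fits covers
  ...   | j , u+j≡a | lower , upper = forbidden red k witness k-coloured
    where
    k : ℕ
    k = a + d
    k-coloured : Coloured red k
    k-coloured = in-range k (s≤s z≤n) k≤2n , k-red
    a-coloured : Coloured red a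
    a-coloured = small-in-range a (s≤s z≤n) ≤-refl , a-red
    reorder : ∀ j p u → j + (p + u) ≡ (u + j) + p
    reorder = solve-∀
    length-eq : j + (p + u) ≡ n
    length-eq = trans (reorder j p u) (cong (_+ p) u+j≡a)
    sum-eq : j * k + u * k ≡ a * k
    sum-eq = trans (sym (*-distribʳ-+ k j u)) (cong (_* k) (trans (+-comm j u) u+j≡a))
    witness : SumOf (Coloured red) n (a * k)
    witness = recount length-eq sum-eq
      (copies j k k-coloured ⊕ consecutive-sum (p + u) b (u * k) lower upper b-coloured b+1-coloured a-coloured)

  a≤window : ∀ k → n ∸ 2 ≤ k → a ≤ k
  a≤window k lo = +-cancelʳ-≤ 2 a k (begin
    a + 2  ≤⟨ +-monoʳ-≤ a 2≤p ⟩
    n      ≤⟨ m≤n+m∸n n 2 ⟩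
    2 + (n ∸ 2) ≤⟨ +-monoʳ-≤ 2 lo ⟩
    2 + k  ≡⟨ +-comm 2 k ⟩
    k + 2  ∎)
    where open ≤-Reasoning

  window-shape : ∀ k → n ∸ 2 ≤ k → k ≤ n + n →
    Σ ℕ λ d → a + d ≡ k × p ≤ d + 2 × d ≤ (p + p) + a
  window-shape k lo hi with m≤n⇒∃[o]m+o≡n (a≤window k lo)
  ... | d , refl = d , refl , p≤ , d≤
    where
    shift : ∀ a d → 2 + (a + d) ≡ a + (d + 2)
    shift = solve-∀
    double-n : ∀ a p → (a + p) + (a + p) ≡ a + ((p + p) + a)
    double-n = solve-∀
    p≤ : p ≤ d + 2
    p≤ = +-cancelˡ-≤ a p (d + 2)
           (≤-trans (≤-trans (m≤n+m∸n n 2) (+-monoʳ-≤ 2 lo)) (≤-reflexive (shift a d)))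
    d≤ : d ≤ (p + p) + a
    d≤ = +-cancelˡ-≤ a d ((p + p) + a) (≤-trans hi (≤-reflexive (double-n a p)))

  window-blue : ∀ k → n ∸ 2 ≤ k → k ≤ n + n → χ k ≡ blue
  window-blue k lo hi with χ k in k-colour | window-shape k lo hi
  ... | false | _ = refl
  ... | true  | d , refl , p≤ , d≤ = ⊥-elim (window-not-red d p≤ d≤ hi k-colour)

≤-ceiling : ∀ q n a .{{_ : NonZero a}} → q * a ≤ n + (a ∸ 1) → q ≤ ⌈ n / a ⌉
≤-ceiling q n a qa≤ = ≤-trans (≤-reflexive (sym (m*n/n≡m q a))) (/-monoˡ-≤ a qa≤)

-- C(n+1, a) ≥ 2n once 2a² ≤ n + a - 1: then ⌈n/a⌉ ≥ 2a, so
-- n·⌈n/a⌉ ≥ 2n·a.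
C-large : ∀ a n .{{_ : NonZero a}} → 2 * (a * a) ≤ n + (a ∸ 1) → n + n ≤ C (suc n) a
C-large a n sq≤ = ≤-ceiling (n + n) (n * ⌈ n / a ⌉) a (begin
    (n + n) * a           ≡⟨ twice n a ⟩
    n * (2 * a)           ≤⟨ *-monoʳ-≤ n 2a≤ ⟩
    n * ⌈ n / a ⌉         ≤⟨ m≤m+n (n * ⌈ n / a ⌉) (a ∸ 1) ⟩
    n * ⌈ n / a ⌉ + (a ∸ 1) ∎)
  where
  open ≤-Reasoning
  twice : ∀ n a → (n + n) * a ≡ n * (2 * a)
  twice = solve-∀
  2a≤ : 2 * a ≤ ⌈ n / a ⌉
  2a≤ = ≤-ceiling (2 * a) n a (≤-trans (≤-reflexive (*-assoc 2 a a)) sq≤)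

-- With a = a′ + 1, the hypothesis m ≥ 2a² - a + 2 means m = a + p + 1
-- with p ≥ 2a·a′ + 1; we record the two consequences that are used:
-- p ≥ a·a′ and 2a² ≤ n + a′ for n = a + p.  Only these properties of p
-- matter, so the definition is opaque (unfolding it is costly).
opaque
  size-bound : ∀ a′ m → 2 * (suc a′ * suc a′) ∸ suc a′ + 2 ≤ m →
    Σ ℕ λ p → m ≡ suc (suc a′ + p) × suc a′ * a′ ≤ p × 2 * (suc a′ * suc a′) ≤ (suc a′ + p) + a′
  size-bound a′ m hm with m≤n⇒∃[o]m+o≡n hm
  ... | o , eq = p , m≡ , a·a′≤p , ≤-trans (m≤m+n _ o) (≤-reflexive (sym (square a′ o)))
    where
    a p : ℕ
    a = suc a′
    p = 2 * (a * a′) + 1 + o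
    split : ∀ a′ → 2 * (suc a′ * suc a′) ≡ (suc a′ + 2 * (suc a′ * a′)) + suc a′
    split = solve-∀
    excess : 2 * (a * a) ∸ a ≡ a + 2 * (a * a′)
    excess = trans (cong (_∸ a) (split a′)) (m+n∸n≡m (a + 2 * (a * a′)) a)
    total : ∀ a′ o → suc a′ + 2 * (suc a′ * a′) + 2 + o ≡ suc (suc a′ + (2 * (suc a′ * a′) + 1 + o))
    total = solve-∀
    m≡ : m ≡ suc (a + p)
    m≡ = trans (sym eq) (trans (cong (λ x → x + 2 + o) excess) (total a′ o))
    a·a′≤p : a * a′ ≤ p
    a·a′≤p = ≤-trans (m≤m+n (a * a′) (a * a′ + 0)) (≤-trans (m≤m+n _ 1) (m≤m+n _ o))
    square : ∀ a′ o → (suc a′ + (2 * (suc a′ * a′) + 1 + o)) + a′ ≡ 2 * (suc a′ * suc a′) + o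
    square = solve-∀

2*suc∸2 : ∀ n → 2 * suc n ∸ 2 ≡ n + n
2*suc∸2 n = cong (_∸ 2) (expand n)
  where
  expand : ∀ n → 2 * suc n ≡ 2 + (n + n)
  expand = solve-∀

lemma7 : (a m : ℕ) → .{{_ : NonZero a}} → 3 ≤ a → 2 * (a * a) ∸ a + 2 ≤ m →
    (χ : Coloring) → NoMonoSolution χ (C m a) m a →
    χ (a ∸ 2) ≡ red → χ (a ∸ 1) ≡ red →
    (k : ℕ) → m ∸ 3 ≤ k → k ≤ 2 * m ∸ 2 → χ k ≡ blue
-- a = b + 2 with b = c + 1 ≥ 1; split m as a + p + 1 and apply BlueWindow
-- to the range {1, …, C(m, a)}, which contains {1, …, 2m - 2}.
lemma7 (suc zero) m (s≤s ())
lemma7 (suc (suc zero)) m (s≤s (s≤s ()))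
lemma7 a@(suc (suc (suc c))) m _ hm χ no-mono b-red b+1-red k lo hi with size-bound (suc (suc c)) m hm
... | p , refl , p-large , square-bound =
  BlueWindow.window-blue (suc c) p (C (suc n) a) χ no-mono (s≤s z≤n) p-large
    (C-large a n square-bound) b-red b+1-red k lo (subst (k ≤_) (2*suc∸2 n) hi)
  where
  n : ℕ
  n = a + p
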